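{- Fix $k\ge2$. If $m\equiv^s_k d\cdot(p+1)+q$ with $p>0$, then $d\cdot p+q$ is in simplified normal form, i.e. $d\cdot p+q\equiv^s_k d\cdot p+q$.
   Context: Ackermann function: for $k\ge 2$, $a,b\ge 0$: $A_a(k,-1):=1$, $A_0(k,b):=k^b$, $A_{a+1}(k,b):=A_a(k,\cdot)^k(A_{a+1}(k,b-1))$, with $f^j$ the $j$-fold iterate; write $A_xy=A_x(k,y)$. $k$-normal form: for $m>0$, $m\equiv_k A_ab+c$ means $m=A_ab+c$ and there exist $n\ge1$ and naturals $a_1..a_n$, $b_1..b_n$, $m_0..m_n$ with $m_0=0$; for $0\le i<n$: $A_{a_{i+1}}m_i\le m<A_{a_{i+1}+1}m_i$, $A_{a_{i+1}}b_{i+1}\le m<A_{a_{i+1}}(b_{i+1}+1)$, $m_{i+1}=A_{a_{i+1}}b_{i+1}$; $A_0m_n>m$; $a=a_n$, $b=b_n$ (unique for each $m>0$). Extended $k$-normal form: $m\equiv^e_k A_ab\cdot p+q$ means $m\equiv_k A_ab+c$ for some $c$, $m=A_ab\cdot p+q$, and $0\le q<A_ab$. Simplified $k$-normal form: $m\equiv^s_k d\cdot p+q$ means there are $a,b$ with $d=A_ab$ and $m\equiv^e_k A_ab\cdot p+q$. -}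

module Defs where

open import Data.Nat using (ℕ; zero; suc; _+_; _*_; _^_; _≤_; _<_)
open import Data.Product using (Σ; ∃; _×_)
open import Relation.Binary.PropositionalEquality using (_≡_)

iter : ℕ → (ℕ → ℕ) → ℕ → ℕ
iter zero    f x = x
iter (suc j) f x = f (iter j f x)

-- A' k a n = A_a(k, n - 1), i.e. the Ackermann function with its
-- second argument shifted by one so that the base case b = -1 is n = 0.
A' : ℕ → ℕ → ℕ → ℕ
A' k a       zero    = 1
A' k zero    (suc n) = k ^ n
A' k (suc a) (suc n) = iter k (λ y → A' k a (suc y)) (A' k (suc a) n)

A : ℕ → ℕ → ℕ → ℕ
A k a b = A' k a (suc b)

-- k-normal form:  m ≡_k A_a b + c
-- The sequences a_1..a_n, b_1..b_n, m_0..m_n are given as functions ℕ → ℕ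
-- (only the indices in range matter).
NF : ℕ → ℕ → ℕ → ℕ → ℕ → Set
NF k m a b c =
  0 < m × m ≡ A k a b + c ×
  Σ ℕ λ n → Σ (ℕ → ℕ) λ as → Σ (ℕ → ℕ) λ bs → Σ (ℕ → ℕ) λ ms →
    1 ≤ n × ms 0 ≡ 0 ×
    (∀ i → i < n →
        (A k (as (suc i)) (ms i) ≤ m × m < A k (suc (as (suc i))) (ms i)) ×
        (A k (as (suc i)) (bs (suc i)) ≤ m × m < A k (as (suc i)) (suc (bs (suc i)))) ×
        ms (suc i) ≡ A k (as (suc i)) (bs (suc i))) ×
    m < A k 0 (ms n) ×
    a ≡ as n × b ≡ bs n

ENF : ℕ → ℕ → ℕ → ℕ → ℕ → ℕ → Set
ENF k m a b p q =
  (∃ λ c → NF k m a b c) × m ≡ A k a b * p + q × q < A k a b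

SNF : ℕ → ℕ → ℕ → ℕ → ℕ → Set
SNF k m d p q = Σ ℕ λ a → Σ ℕ λ b → d ≡ A k a b × ENF k m a b p q

-- Every bound in the definition of the k-normal form of m is either an upper
-- bound m < …, which survives decreasing m, or a lower bound A_{a_{i+1}} m_i ≤ m
-- or A_{a_{i+1}} b_{i+1} ≤ m. The lower bounds are all dominated by
-- m_n = A_a b, because the m_i increase. Hence the normal form of m is also one
-- of every m′ with A_a b ≤ m′ ≤ m, and d·p + q lies between d and d·(p+1) + q.
module Submission where

open import Defs
open import Data.Nat using (ℕ; zero; suc; _+_; _*_; _^_; _≤_; _<_; _≤′_; ≤′-refl; ≤′-step; z≤n; s≤s; z<s; >-nonZero)
open import Data.Nat.Properties
open import Data.Product using (_×_; _,_)
open import Relation.Binary.PropositionalEquality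

≤-stepwise-mono : (f : ℕ → ℕ) {m n : ℕ} → (∀ i → i < n → f i ≤ f (suc i)) → m ≤ n → f m ≤ f n
≤-stepwise-mono f step m≤n = go step (≤⇒≤′ m≤n)
  where
  go : ∀ {m n} → (∀ i → i < n → f i ≤ f (suc i)) → m ≤′ n → f m ≤ f n
  go step ≤′-refl             = ≤-refl
  go step (≤′-step {n} m≤′n) = ≤-trans (go (λ i i<n → step i (m<n⇒m<1+n i<n)) m≤′n) (step n ≤-refl)

iter-inflationary : (j : ℕ) (f : ℕ → ℕ) → (∀ y → y ≤ f y) → ∀ x → x ≤ iter j f x
iter-inflationary zero    f f-infl x = ≤-refl
iter-inflationary (suc j) f f-infl x = ≤-trans (iter-inflationary j f f-infl x) (f-infl (iter j f x))

iter-strictly-inflationary : ∀ {j} → 1 ≤ j → (f : ℕ → ℕ) → (∀ y → y < f y) → ∀ x → x < iter j f x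
iter-strictly-inflationary {suc j} _ f f-infl x =
  ≤-<-trans (iter-inflationary j f (λ y → <⇒≤ (f-infl y)) x) (f-infl (iter j f x))

n<k^n : ∀ {k} → 1 < k → ∀ n → n < k ^ n
n<k^n 1<k zero    = s≤s z≤n
n<k^n 1<k (suc n) = ≤-<-trans (n<k^n 1<k n) (^-monoʳ-< _ 1<k (n<1+n n))

module _ (k : ℕ) (2≤k : 2 ≤ k) where

  A'-inflationary : ∀ a n → n ≤ A' k a n
  A'-inflationary a       zero    = z≤n
  A'-inflationary zero    (suc n) = n<k^n 2≤k n
  A'-inflationary (suc a) (suc n) =
    ≤-<-trans (A'-inflationary (suc a) n)
      (iter-strictly-inflationary (<-trans z<s 2≤k) _ (λ y → A'-inflationary a (suc y)) _)

  A'-step : ∀ a n → A' k a n ≤ A' k a (suc n)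
  A'-step zero    zero    = ≤-refl
  A'-step zero    (suc n) = ^-monoʳ-≤ k {{>-nonZero (<-trans z<s 2≤k)}} (n≤1+n n)
  A'-step (suc a) n       = iter-inflationary k _ (λ y → <⇒≤ (A'-inflationary a (suc y))) _

  A-monoʳ-≤ : ∀ a {x y} → x ≤ y → A k a x ≤ A k a y
  A-monoʳ-≤ a x≤y = ≤-stepwise-mono (A' k a) (λ n _ → A'-step a n) (s≤s x≤y)

  A-inflationary : ∀ a b → b < A k a b
  A-inflationary a b = A'-inflationary a (suc b)

  A-bracket⇒≤ : ∀ a {x y m} → A k a x ≤ m → m < A k a (suc y) → x ≤ y
  A-bracket⇒≤ a lo hi = ≮⇒≥ λ y<x → <-irrefl refl (<-≤-trans hi (≤-trans (A-monoʳ-≤ a y<x) lo))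

  NF-lower : ∀ {m m' a b c c'} → NF k m a b c → m' ≡ A k a b + c' → m' ≤ m → NF k m' a b c'
  NF-lower {m' = m'} {a} {b} (_ , _ , suc j , as , bs , ms , 1≤n@(s≤s z≤n) , ms0 , conds , top , a≡ , b≡) m'≡ m'≤m =
    <-≤-trans (s≤s z≤n) (≤-trans (A-inflationary a b) A≤m') , m'≡ ,
    suc j , as , bs , ms , 1≤n , ms0 , conds' , ≤-<-trans m'≤m top , a≡ , b≡
    where
    A≤m' : A k a b ≤ m'
    A≤m' = ≤-trans (m≤m+n _ _) (≤-reflexive (sym m'≡))

    ms-last : ms (suc j) ≡ A k a b
    ms-last with conds j ≤-refl
    ... | _ , _ , ms≡ = trans ms≡ (sym (cong₂ (A k) a≡ b≡))

    ms≤bs : ∀ i → i < suc j → ms i ≤ bs (suc i)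
    ms≤bs i i<n with conds i i<n
    ... | (lo , _) , (_ , hi) , _ = A-bracket⇒≤ (as (suc i)) lo hi

    ms-step : ∀ i → i < suc j → ms i ≤ ms (suc i)
    ms-step i i<n with conds i i<n
    ... | _ , _ , ms≡ = begin
      ms i                            ≤⟨ ms≤bs i i<n ⟩
      bs (suc i)                      ≤⟨ <⇒≤ (A-inflationary (as (suc i)) (bs (suc i))) ⟩
      A k (as (suc i)) (bs (suc i))   ≡⟨ ms≡ ⟨
      ms (suc i)                      ∎
      where open ≤-Reasoning

    ms≤m' : ∀ i → i < suc j → ms (suc i) ≤ m'
    ms≤m' i i<n = ≤-trans (≤-stepwise-mono ms ms-step i<n) (≤-trans (≤-reflexive ms-last) A≤m')

    conds' : ∀ i → i < suc j →
      (A k (as (suc i)) (ms i) ≤ m' × m' < A k (suc (as (suc i))) (ms i)) ×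
      (A k (as (suc i)) (bs (suc i)) ≤ m' × m' < A k (as (suc i)) (suc (bs (suc i)))) ×
      ms (suc i) ≡ A k (as (suc i)) (bs (suc i))
    conds' i i<n with conds i i<n
    ... | (_ , hi₁) , (_ , hi₂) , ms≡ =
      (≤-trans (A-monoʳ-≤ (as (suc i)) (ms≤bs i i<n)) bs-lo , ≤-<-trans m'≤m hi₁) ,
      (bs-lo , ≤-<-trans m'≤m hi₂) , ms≡
      where
      bs-lo : A k (as (suc i)) (bs (suc i)) ≤ m'
      bs-lo = ≤-trans (≤-reflexive (sym ms≡)) (ms≤m' i i<n)

corollary3p10 : (k : ℕ) → 2 ≤ k → (m d p q : ℕ) → 0 < p →
    SNF k m d (suc p) q → SNF k (d * p + q) d p q
corollary3p10 k 2≤k m d (suc p) q _ (a , b , refl , ((c , nf) , m≡ , q<d)) =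
  a , b , refl , ((d * p + q , NF-lower k 2≤k nf m'≡ m'≤m) , refl , q<d)
  where
  m'≡ : d * suc p + q ≡ d + (d * p + q)
  m'≡ = trans (cong (_+ q) (*-suc d p)) (+-assoc d (d * p) q)

  m'≤m : d * suc p + q ≤ m
  m'≤m = ≤-trans (+-monoˡ-≤ q (*-monoʳ-≤ d (n≤1+n (suc p)))) (≤-reflexive (sym m≡))
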